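{- For every stack $s$ and every quantifier-free symbolic heap $A$ of array separation logic, $s\models\gamma(A)$ if and only if there exists a heap $h$ with $s,h\models A$.
   Context: Array separation logic (ASL). Terms: $t ::= x \mid n \mid t+t \mid n\,t$ ($x$ a variable, $n\in\mathbb{N}$). Pure formulas $\Pi$: finite conjunctions of $t=t$, $t\neq t$, $t\le t$, $t<t$. Spatial formulas: $F ::= \mathsf{emp} \mid t\mapsto t \mid \mathsf{array}(t,t) \mid F * F$. A quantifier-free symbolic heap is $\Pi : F$. Stacks $s:\mathsf{Var}\to\mathbb{N}$ (extended to terms homomorphically); heaps are finite partial functions $\mathbb{N}\rightharpoonup\mathbb{N}$, with $h_1\circ h_2$ the union of domain-disjoint heaps. Satisfaction: $s,h\models t_1\sim t_2$ iff $s(t_1)\sim s(t_2)$; $s,h\models\mathsf{emp}$ iff $\mathrm{dom}(h)=\emptyset$; $s,h\models t_1\mapsto t_2$ iff $\mathrm{dom}(h)=\{s(t_1)\}$ and $h(s(t_1))=s(t_2)$; $s,h\models\mathsf{array}(t_1,t_2)$ iff $s(t_1)\le s(t_2)$ and $\mathrm{dom}(h)=\{s(t_1),\dots,s(t_2)\}$; $s,h\models F_1*F_2$ iff $h=h_1\circ h_2$ with $s,h_i\models F_i$; $s,h\models\Pi:F$ iff $s,h\models\Pi$ and $s,h\models F$. For a pure formula / Presburger formula $\phi$, $s\models\phi$ is ordinary first-order satisfaction over $\mathbb{N}$. Array abstraction: for $A=\Pi : \mathop{*}_{i=1}^n\mathsf{array}(a_i,b_i) * \mathop{*}_{i=1}^m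 c_i\mapsto d_i$, $\lfloor A\rfloor$ replaces each $c_i\mapsto d_i$ by $\mathsf{array}(c_i,c_i)$. If $\lfloor A\rfloor = \Pi : \mathop{*}_{i=1}^N\mathsf{array}(\hat a_i,\hat b_i)$, then $\gamma(A) = \Pi \wedge \bigwedge_{1\le i\le N}\hat a_i\le \hat b_i \wedge \bigwedge_{1\le i<j\le N}\big((\hat b_i<\hat a_j)\vee(\hat b_j<\hat a_i)\big)$, a formula of Presburger arithmetic. -}

module Defs where

open import Data.Nat using (ℕ; _+_; _*_; _≤_; _<_)
open import Data.Maybe using (Maybe; just; nothing; _<∣>_)
open import Data.List using (List; []; _∷_; _++_; map)
open import Data.Product using (Σ; ∃; _×_; _,_)
open import Data.Sum using (_⊎_)
open import Data.Unit using (⊤)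
open import Relation.Nullary using (¬_)
open import Relation.Binary.PropositionalEquality using (_≡_)

Var : Set
Var = ℕ

data Term : Set where
  var   : Var → Term
  const : ℕ → Term
  _⊕_   : Term → Term → Term
  _⊛_   : ℕ → Term → Term

Stack : Set
Stack = Var → ℕ

⟦_⟧ : Term → Stack → ℕ
⟦ var x ⟧ s = s x
⟦ const n ⟧ s = n
⟦ t ⊕ u ⟧ s = ⟦ t ⟧ s + ⟦ u ⟧ s
⟦ n ⊛ t ⟧ s = n * ⟦ t ⟧ s

data PureAtom : Set where
  _≐_ _≠_ _≤ₜ_ _<ₜ_ : Term → Term → PureAtom

Pure : Set
Pure = List PureAtom

data Spatial : Set where
  emp   : Spatial
  _↦_   : Term → Term → Spatial
  array : Term → Term → Spatial
  _✶_   : Spatial → Spatial → Spatial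

record SymHeap : Set where
  constructor _∶_
  field
    pure    : Pure
    spatial : Spatial

record Heap : Set where
  field
    fun    : ℕ → Maybe ℕ
    finite : ∃ λ N → ∀ k → N ≤ k → fun k ≡ nothing
open Heap public

InDom : Heap → ℕ → Set
InDom h k = ∃ λ v → fun h k ≡ just v

IsUnion : Heap → Heap → Heap → Set
IsUnion h h₁ h₂ =
  (∀ k → fun h₁ k ≡ nothing ⊎ fun h₂ k ≡ nothing) ×
  (∀ k → fun h k ≡ (fun h₁ k <∣> fun h₂ k))

⊨atom : Stack → PureAtom → Set
⊨atom s (t ≐ u)  = ⟦ t ⟧ s ≡ ⟦ u ⟧ s
⊨atom s (t ≠ u)  = ¬ (⟦ t ⟧ s ≡ ⟦ u ⟧ s)
⊨atom s (t ≤ₜ u) = ⟦ t ⟧ s ≤ ⟦ u ⟧ s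
⊨atom s (t <ₜ u) = ⟦ t ⟧ s < ⟦ u ⟧ s

⊨pure : Stack → Pure → Set
⊨pure s []       = ⊤
⊨pure s (a ∷ as) = ⊨atom s a × ⊨pure s as

⊨sp : Stack → Heap → Spatial → Set
⊨sp s h emp = ∀ k → ¬ InDom h k
⊨sp s h (t ↦ u) =
  (∀ k → InDom h k → k ≡ ⟦ t ⟧ s) × fun h (⟦ t ⟧ s) ≡ just (⟦ u ⟧ s)
⊨sp s h (array t u) =
  ⟦ t ⟧ s ≤ ⟦ u ⟧ s ×
  (∀ k → InDom h k → (⟦ t ⟧ s ≤ k × k ≤ ⟦ u ⟧ s)) ×
  (∀ k → ⟦ t ⟧ s ≤ k → k ≤ ⟦ u ⟧ s → InDom h k)
⊨sp s h (F ✶ G) =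
  Σ Heap λ h₁ → Σ Heap λ h₂ → IsUnion h h₁ h₂ × ⊨sp s h₁ F × ⊨sp s h₂ G

_,_⊨_ : Stack → Heap → SymHeap → Set
s , h ⊨ (Π ∶ F) = ⊨pure s Π × ⊨sp s h F

-- Presburger formulas (quantifier-free fragment suffices for γ)
data PForm : Set where
  atom : PureAtom → PForm
  ⊤ᵖ   : PForm
  _∧ᵖ_ _∨ᵖ_ : PForm → PForm → PForm

_⊨ᵖ_ : Stack → PForm → Set
s ⊨ᵖ atom a   = ⊨atom s a
s ⊨ᵖ ⊤ᵖ       = ⊤
s ⊨ᵖ (φ ∧ᵖ ψ) = s ⊨ᵖ φ × s ⊨ᵖ ψ
s ⊨ᵖ (φ ∨ᵖ ψ) = s ⊨ᵖ φ ⊎ s ⊨ᵖ ψ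

arrays : Spatial → List (Term × Term)
arrays emp         = []
arrays (t ↦ u)     = (t , t) ∷ []
arrays (array t u) = (t , u) ∷ []
arrays (F ✶ G)     = arrays F ++ arrays G

⋀ : List PForm → PForm
⋀ []       = ⊤ᵖ
⋀ (φ ∷ φs) = φ ∧ᵖ ⋀ φs

disjoint : Term × Term → Term × Term → PForm
disjoint (a , b) (a' , b') = atom (b <ₜ a') ∨ᵖ atom (b' <ₜ a)

pairwise : List (Term × Term) → PForm
pairwise []       = ⊤ᵖ
pairwise (x ∷ xs) = ⋀ (map (disjoint x) xs) ∧ᵖ pairwise xs

γ : SymHeap → PForm
γ (Π ∶ F) =
  ⋀ (map atom Π) ∧ᵖ
  (⋀ (map (λ { (a , b) → atom (a ≤ₜ b) }) (arrays F)) ∧ᵖ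
   pairwise (arrays F))

-- Necessity: the cells of each interval are allocated in the part of the heap
-- that satisfies the corresponding atom, and two domain-disjoint heaps cannot
-- both allocate the cell max(a, a′) that two overlapping intervals [a, b],
-- [a′, b′] share. Sufficiency: the union of one block of cells per interval is
-- a model, and the blocks are domain-disjoint because the intervals are.
module Submission where

open import Defs
open import Data.Product using (Σ; _×_)
open import Function.Bundles using (_⇔_)

open import Data.Nat using (ℕ; suc; _≤_; _<_; _⊔_; _≤?_)
open import Data.Nat.Properties
  using ( ≤-refl; ≤-trans; ≤-antisym; <-≤-connex; <⇒≱
        ; ⊔-lub; m≤m⊔n; m≤n⊔m; m⊔n≤o⇒m≤o; m⊔n≤o⇒n≤o )
open import Data.Maybe using (Maybe; just; nothing; _<∣>_)
open import Data.List using ([]; _∷_; _++_; map)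
open import Data.List.Relation.Unary.All as All using (All; []; _∷_; lookupAny)
import Data.List.Relation.Unary.All.Properties as All
open import Data.List.Relation.Unary.Any using (Any; here)
import Data.List.Relation.Unary.Any.Properties as Any
open import Data.List.Relation.Unary.AllPairs using (AllPairs; []; _∷_)
import Data.List.Relation.Unary.AllPairs.Properties as AllPairs
open import Data.Product using (∃; _,_; proj₁; proj₂)
open import Data.Product.Function.NonDependent.Propositional using (_×-⇔_)
open import Data.Sum using (_⊎_; inj₁; inj₂)
open import Data.Unit using (tt)
open import Data.Empty using (⊥; ⊥-elim)
open import Function.Base using (_∘_; _on_)
open import Function.Bundles using (mk⇔; Equivalence)
open import Relation.Nullary using (yes; no)
open import Relation.Nullary.Decidable using (_×-dec_)
open import Relation.Binary.PropositionalEquality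
  using (_≡_; _≢_; refl; sym; trans; cong; cong₂; subst; module ≡-Reasoning)

AllPairs-++⁻ : ∀ {A : Set} {R : A → A → Set} xs {ys} → AllPairs R (xs ++ ys) →
               AllPairs R xs × AllPairs R ys × All (λ x → All (R x) ys) xs
AllPairs-++⁻ []       Rys = [] , Rys , []
AllPairs-++⁻ (x ∷ xs) (Rx ∷ Rxsys) =
  let (Rxs , Rys , Rxsys′) = AllPairs-++⁻ xs Rxsys
  in  All.++⁻ˡ xs Rx ∷ Rxs , Rys , All.++⁻ʳ xs Rx ∷ Rxsys′

nothing≢just : ∀ {A : Set} {x : A} → nothing ≢ just x
nothing≢just ()

Separate : Heap → Heap → Set
Separate h₁ h₂ = ∀ k → fun h₁ k ≡ nothing ⊎ fun h₂ k ≡ nothing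

Separate⇒¬common : ∀ h₁ h₂ → Separate h₁ h₂ → ∀ k → InDom h₁ k → InDom h₂ k → ⊥
Separate⇒¬common _ _ sep k (_ , e₁) (_ , e₂) with sep k
... | inj₁ e = nothing≢just (trans (sym e) e₁)
... | inj₂ e = nothing≢just (trans (sym e) e₂)

¬common⇒Separate : ∀ h₁ h₂ → (∀ k → InDom h₁ k → InDom h₂ k → ⊥) → Separate h₁ h₂
¬common⇒Separate h₁ h₂ ¬common k with fun h₁ k in e₁ | fun h₂ k in e₂
... | nothing | _       = inj₁ refl
... | just _  | nothing = inj₂ refl
... | just v₁ | just v₂ = ⊥-elim (¬common k (v₁ , e₁) (v₂ , e₂))

IsUnion⇒InDomˡ : ∀ h h₁ h₂ {k} → IsUnion h h₁ h₂ → InDom h₁ k → InDom h k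
IsUnion⇒InDomˡ _ _ h₂ {k} (_ , union) (v , e) =
  v , trans (union k) (cong (_<∣> fun h₂ k) e)

IsUnion⇒InDomʳ : ∀ h h₁ h₂ {k} → IsUnion h h₁ h₂ → InDom h₂ k → InDom h k
IsUnion⇒InDomʳ h h₁ h₂ {k} (sep , union) (v , e) with sep k
... | inj₂ e₂ = ⊥-elim (nothing≢just (trans (sym e₂) e))
... | inj₁ e₁ = v , (begin
  fun h k                  ≡⟨ union k ⟩
  fun h₁ k <∣> fun h₂ k    ≡⟨ cong (_<∣> fun h₂ k) e₁ ⟩
  fun h₂ k                 ≡⟨ e ⟩
  just v                   ∎)
  where open ≡-Reasoning

∅ : Heap
∅ = record { fun = λ _ → nothing ; finite = 0 , λ _ _ → refl }

_∪_ : Heap → Heap → Heap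
h₁ ∪ h₂ = record
  { fun    = λ k → fun h₁ k <∣> fun h₂ k
  ; finite = N₁ ⊔ N₂ , λ k N≤k →
      cong₂ _<∣>_ (beyond₁ k (m⊔n≤o⇒m≤o N₁ N₂ N≤k)) (beyond₂ k (m⊔n≤o⇒n≤o N₁ N₂ N≤k))
  }
  where
  N₁ = proj₁ (finite h₁)
  N₂ = proj₁ (finite h₂)
  beyond₁ = proj₂ (finite h₁)
  beyond₂ = proj₂ (finite h₂)

∪-IsUnion : ∀ h₁ h₂ → Separate h₁ h₂ → IsUnion (h₁ ∪ h₂) h₁ h₂
∪-IsUnion _ _ sep = sep , λ _ → refl

Interval : Set
Interval = ℕ × ℕ

NonEmpty : Interval → Set
NonEmpty (a , b) = a ≤ b

_∈ᵢ_ : ℕ → Interval → Set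
k ∈ᵢ (a , b) = a ≤ k × k ≤ b

Disjoint : Interval → Interval → Set
Disjoint (a , b) (a′ , b′) = b < a′ ⊎ b′ < a

Disjoint⇒¬common : ∀ {x y k} → Disjoint x y → k ∈ᵢ x → k ∈ᵢ y → ⊥
Disjoint⇒¬common (inj₁ b<a′) (_ , k≤b) (a′≤k , _) = <⇒≱ b<a′ (≤-trans a′≤k k≤b)
Disjoint⇒¬common (inj₂ b′<a) (a≤k , _) (_ , k≤b′) = <⇒≱ b′<a (≤-trans a≤k k≤b′)

Disjoint-or-common : ∀ {x y} → NonEmpty x → NonEmpty y →
                     Disjoint x y ⊎ ∃ λ k → k ∈ᵢ x × k ∈ᵢ y
Disjoint-or-common {a , b} {a′ , b′} a≤b a′≤b′ with <-≤-connex b a′ | <-≤-connex b′ a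
... | inj₁ b<a′ | _         = inj₁ (inj₁ b<a′)
... | inj₂ _    | inj₁ b′<a = inj₁ (inj₂ b′<a)
... | inj₂ a′≤b | inj₂ a≤b′ =
  inj₂ (a ⊔ a′ , (m≤m⊔n a a′ , ⊔-lub a≤b a′≤b) , (m≤n⊔m a a′ , ⊔-lub a≤b′ a′≤b′))

record Allocated (h : Heap) (x : Interval) : Set where
  constructor _,_
  field
    nonEmpty : NonEmpty x
    cover    : ∀ k → k ∈ᵢ x → InDom h k

Allocated-mono : ∀ {h h′ x} → (∀ {k} → InDom h k → InDom h′ k) →
                 Allocated h x → Allocated h′ x
Allocated-mono h⊆h′ (x≠∅ , cover) = x≠∅ , λ k k∈x → h⊆h′ (cover k k∈x)

Separate⇒Disjoint : ∀ {h₁ h₂ x y} → Separate h₁ h₂ →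
                    Allocated h₁ x → Allocated h₂ y → Disjoint x y
Separate⇒Disjoint {h₁} {h₂} sep (x≠∅ , cover₁) (y≠∅ , cover₂)
  with Disjoint-or-common x≠∅ y≠∅
... | inj₁ x#y = x#y
... | inj₂ (k , k∈x , k∈y) =
  ⊥-elim (Separate⇒¬common h₁ h₂ sep k (cover₁ k k∈x) (cover₂ k k∈y))

blockCell : Interval → ℕ → ℕ → Maybe ℕ
blockCell (a , b) v k with a ≤? k ×-dec k ≤? b
... | yes _ = just v
... | no _  = nothing

blockCell-beyond : ∀ a b v k → suc b ≤ k → blockCell (a , b) v k ≡ nothing
blockCell-beyond a b v k b<k with a ≤? k ×-dec k ≤? b
... | yes (_ , k≤b) = ⊥-elim (<⇒≱ b<k k≤b)
... | no _          = refl

block : Interval → ℕ → Heap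
block (a , b) v =
  record { fun = blockCell (a , b) v ; finite = suc b , blockCell-beyond a b v }

block-InDom⁻ : ∀ {x v k} → InDom (block x v) k → k ∈ᵢ x
block-InDom⁻ {a , b} {v} {k} _ with a ≤? k ×-dec k ≤? b
... | yes k∈x = k∈x

block-fun : ∀ {x v k} → k ∈ᵢ x → fun (block x v) k ≡ just v
block-fun {a , b} {v} {k} k∈x with a ≤? k ×-dec k ≤? b
... | yes _  = refl
... | no k∉x = ⊥-elim (k∉x k∈x)

module _ (s : Stack) where

  ⟦_⟧ᵢ : Term × Term → Interval
  ⟦ a , b ⟧ᵢ = ⟦ a ⟧ s , ⟦ b ⟧ s

  ⊨sp⇒Allocated×Disjoint : ∀ {h} F → ⊨sp s h F →
    All (Allocated h ∘ ⟦_⟧ᵢ) (arrays F) × AllPairs (Disjoint on ⟦_⟧ᵢ) (arrays F)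
  ⊨sp⇒Allocated×Disjoint emp _ = [] , []
  ⊨sp⇒Allocated×Disjoint {h} (t ↦ u) (_ , t↦u) = (≤-refl , cover) ∷ [] , [] ∷ []
    where
    cover : ∀ k → k ∈ᵢ ⟦ t , t ⟧ᵢ → InDom h k
    cover k (t≤k , k≤t) = subst (InDom h) (≤-antisym t≤k k≤t) (⟦ u ⟧ s , t↦u)
  ⊨sp⇒Allocated×Disjoint (array t u) (t≤u , _ , cover) =
    (t≤u , λ k (t≤k , k≤u) → cover k t≤k k≤u) ∷ [] , [] ∷ []
  ⊨sp⇒Allocated×Disjoint {h} (F ✶ G) (h₁ , h₂ , union@(sep , _) , h₁⊨F , h₂⊨G) =
    let (allocF , disjF) = ⊨sp⇒Allocated×Disjoint F h₁⊨F
        (allocG , disjG) = ⊨sp⇒Allocated×Disjoint G h₂⊨G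
    in  All.++⁺ (All.map (Allocated-mono (IsUnion⇒InDomˡ h h₁ h₂ union)) allocF)
                (All.map (Allocated-mono (IsUnion⇒InDomʳ h h₁ h₂ union)) allocG) ,
        AllPairs.++⁺ disjF disjG
          (All.map (λ x-alloc → All.map (Separate⇒Disjoint sep x-alloc) allocG) allocF)

  canonical : Spatial → Heap
  canonical emp         = ∅
  canonical (t ↦ u)     = block ⟦ t , t ⟧ᵢ (⟦ u ⟧ s)
  canonical (array t u) = block ⟦ t , u ⟧ᵢ 0
  canonical (F ✶ G)     = canonical F ∪ canonical G

  canonical-InDom : ∀ F {k} → InDom (canonical F) k → Any (λ x → k ∈ᵢ ⟦ x ⟧ᵢ) (arrays F)
  canonical-InDom emp         (_ , ())
  canonical-InDom (t ↦ u)     k∈dom = here (block-InDom⁻ k∈dom)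
  canonical-InDom (array t u) k∈dom = here (block-InDom⁻ k∈dom)
  canonical-InDom (F ✶ G) {k} (v , e) with fun (canonical F) k in eF
  ... | just w  = Any.++⁺ˡ (canonical-InDom F (w , eF))
  ... | nothing = Any.++⁺ʳ (arrays F) (canonical-InDom G (v , e))

  canonical-Separate : ∀ F G →
                       All (λ x → All ((Disjoint on ⟦_⟧ᵢ) x) (arrays G)) (arrays F) →
                       Separate (canonical F) (canonical G)
  canonical-Separate F G cross =
    ¬common⇒Separate (canonical F) (canonical G) λ k k∈F k∈G →
      let (x#G , k∈x) = lookupAny cross (canonical-InDom F k∈F)
          (x#y , k∈y) = lookupAny x#G (canonical-InDom G k∈G)
      in  Disjoint⇒¬common x#y k∈x k∈y

  canonical-⊨sp : ∀ F → All (NonEmpty ∘ ⟦_⟧ᵢ) (arrays F) →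
                  AllPairs (Disjoint on ⟦_⟧ᵢ) (arrays F) → ⊨sp s (canonical F) F
  canonical-⊨sp emp _ _ = λ _ ()
  canonical-⊨sp (t ↦ u) _ _ =
    (λ k k∈dom → let (t≤k , k≤t) = block-InDom⁻ k∈dom in ≤-antisym k≤t t≤k) ,
    block-fun (≤-refl , ≤-refl)
  canonical-⊨sp (array t u) (t≤u ∷ []) _ =
    t≤u , (λ k → block-InDom⁻) , λ k t≤k k≤u → 0 , block-fun (t≤k , k≤u)
  canonical-⊨sp (F ✶ G) nonEmpty disj =
    let (nonEmptyF , nonEmptyG)  = All.++⁻ (arrays F) nonEmpty
        (disjF , disjG , disjFG) = AllPairs-++⁻ (arrays F) disj
    in  canonical F , canonical G ,
        ∪-IsUnion (canonical F) (canonical G) (canonical-Separate F G disjFG) ,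
        canonical-⊨sp F nonEmptyF disjF , canonical-⊨sp G nonEmptyG disjG

  ⊨⋀-map⇔All : ∀ {A : Set} (f : A → PForm) xs →
               s ⊨ᵖ ⋀ (map f xs) ⇔ All (λ x → s ⊨ᵖ f x) xs
  ⊨⋀-map⇔All f []       = mk⇔ (λ _ → []) (λ _ → tt)
  ⊨⋀-map⇔All f (x ∷ xs) = mk⇔ (λ (p , ps) → p ∷ to ps) (λ { (p ∷ ps) → p , from ps })
    where open Equivalence (⊨⋀-map⇔All f xs)

  ⊨⋀-atoms⇔⊨pure : ∀ Π → s ⊨ᵖ ⋀ (map atom Π) ⇔ ⊨pure s Π
  ⊨⋀-atoms⇔⊨pure []      = mk⇔ (λ _ → tt) (λ _ → tt)
  ⊨⋀-atoms⇔⊨pure (a ∷ Π) = mk⇔ (λ (p , ps) → p , to ps) (λ (p , ps) → p , from ps)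
    where open Equivalence (⊨⋀-atoms⇔⊨pure Π)

  ⊨pairwise⇔AllPairs : ∀ xs → s ⊨ᵖ pairwise xs ⇔ AllPairs (Disjoint on ⟦_⟧ᵢ) xs
  ⊨pairwise⇔AllPairs []       = mk⇔ (λ _ → []) (λ _ → tt)
  ⊨pairwise⇔AllPairs (x ∷ xs) =
    mk⇔ (λ (p , ps) → Equivalence.to (⊨⋀-map⇔All (disjoint x) xs) p ∷ to ps)
        (λ { (p ∷ ps) → Equivalence.from (⊨⋀-map⇔All (disjoint x) xs) p , from ps })
    where open Equivalence (⊨pairwise⇔AllPairs xs)

  ⊨γ⇔ : ∀ Π F → s ⊨ᵖ γ (Π ∶ F) ⇔
        (⊨pure s Π × All (NonEmpty ∘ ⟦_⟧ᵢ) (arrays F) × AllPairs (Disjoint on ⟦_⟧ᵢ) (arrays F))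
  ⊨γ⇔ Π F =
    ⊨⋀-atoms⇔⊨pure Π ×-⇔ (⊨⋀-map⇔All _ (arrays F) ×-⇔ ⊨pairwise⇔AllPairs (arrays F))

lemma13 : (s : Stack) (A : SymHeap) → (s ⊨ᵖ γ A) ⇔ Σ Heap (λ h → s , h ⊨ A)
lemma13 s (Π ∶ F) = mk⇔ satisfiable γ-holds
  where
  open Equivalence (⊨γ⇔ s Π F)

  satisfiable : s ⊨ᵖ γ (Π ∶ F) → Σ Heap (λ h → s , h ⊨ (Π ∶ F))
  satisfiable s⊨γ =
    let (s⊨Π , nonEmpty , disj) = to s⊨γ
    in  canonical s F , s⊨Π , canonical-⊨sp s F nonEmpty disj

  γ-holds : Σ Heap (λ h → s , h ⊨ (Π ∶ F)) → s ⊨ᵖ γ (Π ∶ F)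
  γ-holds (h , s⊨Π , h⊨F) =
    let (allocated , disj) = ⊨sp⇒Allocated×Disjoint s F h⊨F
    in  from (s⊨Π , All.map Allocated.nonEmpty allocated , disj)
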